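{- Let $G$ be a directed graph with designated incoming vertices $i_1,\dots,i_k$ and outgoing vertices $o_1,\dots,o_k$. Suppose the vertex set of $G$ is partitioned into $\{V_1,V_2\}$ such that every edge of $G$ has one endpoint in $V_1$ and the other in $V_2$, that $|V_1|=|V_2|+1$, and that every incoming vertex and every outgoing vertex lies in $V_1$. Then $G$ satisfies the single visit condition.
   Context: All graphs are simple, finite, directed graphs. In a directed graph with $k$ distinct designated incoming vertices $i_1,\dots,i_k$ and $k$ distinct designated outgoing vertices $o_1,\dots,o_k$ (a vertex may be both), the single visit condition is: there is no collection of two or more pairwise vertex-disjoint directed paths, each starting at an incoming vertex and finishing at an outgoing vertex (a single vertex that is both incoming and outgoing counts as such a path), whose union covers all vertices of the graph. -}

module Defs where

open import Data.Nat using (ℕ; suc; _≤_)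
open import Data.Fin using (Fin)
open import Data.Bool using (Bool; true; false; not)
open import Data.List using (List; []; _∷_; length; head; last; filterᵇ; allFin)
open import Data.List.Relation.Unary.Linked using (Linked)
open import Data.List.Relation.Unary.Unique.Propositional using (Unique)
open import Data.List.Relation.Unary.All using (All)
open import Data.List.Relation.Unary.AllPairs using (AllPairs)
open import Data.List.Relation.Unary.Any using (Any)
open import Data.List.Membership.Propositional using (_∈_; _∉_)
open import Data.Maybe using (Maybe; just)
open import Data.Product using (Σ; _×_; ∃)
open import Function.Definitions using (Injective)
open import Relation.Binary.PropositionalEquality using (_≡_; _≢_)
open import Relation.Nullary using (¬_)
open import Level using (0ℓ)

-- A simple finite directed graph on vertex set Fin n: an edge relation
-- with no loops (at most one edge u → v is automatic for a relation).
record Digraph : Set₁ where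
  field
    n     : ℕ
    Edge  : Fin n → Fin n → Set
    loopless : ∀ v → ¬ Edge v v
open Digraph public

record IODigraph (k : ℕ) : Set₁ where
  field
    graph : Digraph
    inc   : Fin k → Fin (n graph)
    out   : Fin k → Fin (n graph)
    inc-injective : Injective _≡_ _≡_ inc
    out-injective : Injective _≡_ _≡_ out
open IODigraph public

module _ {k : ℕ} (G : IODigraph k) where
  private
    V = Fin (n (graph G))
    E = Edge (graph G)

  IsDirectedPath : List V → Set
  IsDirectedPath xs = (xs ≢ []) × Linked E xs × Unique xs

  IsIOPath : List V → Set
  IsIOPath xs = IsDirectedPath xs
              × (∃ λ (j : Fin k) → head xs ≡ just (inc G j))
              × (∃ λ (j : Fin k) → last xs ≡ just (out G j))

  Disjoint : List V → List V → Set
  Disjoint p q = ∀ v → v ∈ p → v ∉ q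

  SingleVisitCondition : Set
  SingleVisitCondition =
    ¬ (Σ (List (List V)) λ ps →
         (2 ≤ length ps)
       × All IsIOPath ps
       × AllPairs Disjoint ps
       × (∀ (v : V) → Any (v ∈_) ps))

countSide : {m : ℕ} → (Fin m → Bool) → Bool → ℕ
countSide {m} side true  = length (filterᵇ side (allFin m))
countSide {m} side false = length (filterᵇ (λ v → not (side v)) (allFin m))

-- Colour V₁ true and V₂ false. An incoming-to-outgoing path alternates colours and starts
-- and ends in V₁, so it has exactly one more true vertex than false ones. Pairwise disjoint
-- paths covering the graph form a permutation of all vertices, so |V₁| − |V₂| would equal the
-- number of paths, which is at least 2; but it is 1.
module Submission where

open import Defs
open import Data.Nat using (ℕ; suc; _+_; _≤_)
open import Data.Nat.Properties using (+-cancelʳ-≡; <-irrefl; +-commutativeSemigroup)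
open import Algebra.Properties.CommutativeSemigroup +-commutativeSemigroup using (x∙yz≈y∙xz)
open import Data.Fin using (Fin)
open import Data.Bool using (Bool; true; false; not)
open import Data.Bool.Properties using (T?; ¬-not)
open import Data.List using (List; []; _∷_; _++_; concat; length; filterᵇ; allFin; last)
open import Data.List.Properties using (length-++; filter-++)
open import Data.List.Relation.Unary.Linked as Linked using (Linked; _∷_)
open import Data.List.Relation.Unary.All as All using (All; []; _∷_)
open import Data.List.Relation.Unary.AllPairs as AllPairs using (AllPairs)
open import Data.List.Relation.Unary.Any using (Any)
open import Data.List.Relation.Unary.Unique.Propositional using (Unique)
open import Data.List.Relation.Unary.Unique.Propositional.Properties using (concat⁺; allFin⁺)
open import Data.List.Membership.Propositional using (_∈_)
open import Data.List.Membership.Propositional.Properties using (∈-allFin; ∈-concat⁺)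
open import Data.List.Membership.Propositional.Properties.WithK using (unique∧set⇒bag)
open import Data.List.Relation.Binary.BagAndSetEquality using (∼bag⇒↭)
open import Data.List.Relation.Binary.Permutation.Propositional using (_↭_)
open import Data.List.Relation.Binary.Permutation.Propositional.Properties using (↭-length; filter-↭)
open import Data.Maybe using (just)
open import Data.Maybe.Properties using (just-injective)
open import Data.Product using (_×_; _,_; proj₁; proj₂)
open import Function using (_∘_)
open import Function.Bundles using (mk⇔)
open import Relation.Binary.PropositionalEquality using (_≡_; _≢_; refl; sym; trans; subst; cong; cong₂; module ≡-Reasoning)
open import Relation.Nullary using (contradiction)

unique∧complete⇒↭allFin : ∀ {n} {xs : List (Fin n)} → Unique xs → (∀ v → v ∈ xs) → xs ↭ allFin n
unique∧complete⇒↭allFin {n} xs! complete =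
  ∼bag⇒↭ (unique∧set⇒bag xs! (allFin⁺ n) (mk⇔ (λ _ → ∈-allFin _) (λ _ → complete _)))

module Colouring {A : Set} (colour : A → Bool) where

  trues falses : List A → ℕ
  trues  xs = length (filterᵇ colour xs)
  falses xs = length (filterᵇ (not ∘ colour) xs)

  Alternating : List A → Set
  Alternating = Linked (λ u v → colour u ≢ colour v)

  trues-++ : ∀ xs ys → trues (xs ++ ys) ≡ trues xs + trues ys
  trues-++ xs ys = trans (cong length (filter-++ (T? ∘ colour) xs ys)) (length-++ (filterᵇ colour xs))

  falses-++ : ∀ xs ys → falses (xs ++ ys) ≡ falses xs + falses ys
  falses-++ xs ys = trans (cong length (filter-++ (T? ∘ not ∘ colour) xs ys)) (length-++ (filterᵇ (not ∘ colour) xs))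

  colour-flips : ∀ {x y b} → colour x ≡ b → colour x ≢ colour y → colour y ≡ not b
  colour-flips cx x≢y = trans (¬-not (x≢y ∘ sym)) (cong not cx)

  counts-∷-true-false : ∀ {x y} zs → colour x ≡ true → colour y ≡ false
    → trues (x ∷ y ∷ zs) ≡ suc (trues zs) × falses (x ∷ y ∷ zs) ≡ suc (falses zs)
  counts-∷-true-false zs cx cy rewrite cx | cy = refl , refl

  trues≡suc-falses-alternating : ∀ {x z} xs → colour x ≡ true → colour z ≡ true
    → Alternating (x ∷ xs) → last (x ∷ xs) ≡ just z → trues (x ∷ xs) ≡ suc (falses (x ∷ xs))
  trues≡suc-falses-alternating [] cx _ _ _ rewrite cx = refl
  trues≡suc-falses-alternating (y ∷ []) cx cz (x≢y ∷ _) refl = contradiction (trans cx (sym cz)) x≢y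
  trues≡suc-falses-alternating {x} (y ∷ w ∷ ws) cx cz (x≢y ∷ y≢w ∷ alt) last≡z = begin
    trues (x ∷ y ∷ w ∷ ws)         ≡⟨ proj₁ (counts-∷-true-false (w ∷ ws) cx cy) ⟩
    suc (trues (w ∷ ws))           ≡⟨ cong suc (trues≡suc-falses-alternating ws cw cz alt last≡z) ⟩
    suc (suc (falses (w ∷ ws)))    ≡⟨ cong suc (proj₂ (counts-∷-true-false (w ∷ ws) cx cy)) ⟨
    suc (falses (x ∷ y ∷ w ∷ ws))  ∎
    where
    open ≡-Reasoning
    cy : colour y ≡ false
    cy = colour-flips cx x≢y
    cw : colour w ≡ true
    cw = colour-flips cy y≢w

  trues-concat : ∀ {ps} → All (λ p → trues p ≡ suc (falses p)) ps
    → trues (concat ps) ≡ length ps + falses (concat ps)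
  trues-concat [] = refl
  trues-concat {p ∷ ps} (eq ∷ eqs) = begin
    trues (p ++ concat ps)                            ≡⟨ trues-++ p (concat ps) ⟩
    trues p + trues (concat ps)                       ≡⟨ cong₂ _+_ eq (trues-concat eqs) ⟩
    suc (falses p + (length ps + falses (concat ps))) ≡⟨ cong suc (x∙yz≈y∙xz (falses p) (length ps) _) ⟩
    suc (length ps + (falses p + falses (concat ps))) ≡⟨ cong (suc ∘ (length ps +_)) (sym (falses-++ p (concat ps))) ⟩
    suc (length ps) + falses (p ++ concat ps)         ∎
    where open ≡-Reasoning

module _ {k : ℕ} (G : IODigraph k) (side : Fin (n (graph G)) → Bool)
         (bipartite : ∀ u v → Edge (graph G) u v → side u ≢ side v)
         (inc-V₁ : ∀ j → side (inc G j) ≡ true)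
         (out-V₁ : ∀ j → side (out G j) ≡ true) where

  open Colouring side

  trues≡suc-falses-IOPath : ∀ p → IsIOPath G p → trues p ≡ suc (falses p)
  trues≡suc-falses-IOPath [] ((p≢[] , _) , _) = contradiction refl p≢[]
  trues≡suc-falses-IOPath (x ∷ xs) ((_ , linked , _) , (i , head≡inc) , (o , last≡out)) =
    trues≡suc-falses-alternating xs (trans (cong side (just-injective head≡inc)) (inc-V₁ i))
      (out-V₁ o) (Linked.map (bipartite _ _) linked) last≡out

  IOPath-cover⇒countSide : ∀ {ps} → All (IsIOPath G) ps → AllPairs (Disjoint G) ps
    → (∀ v → Any (v ∈_) ps) → countSide side true ≡ length ps + countSide side false
  IOPath-cover⇒countSide {ps} paths disjoint cover = begin
    countSide side true            ≡⟨ sym (↭-length (filter-↭ (T? ∘ side) perm)) ⟩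
    trues (concat ps)              ≡⟨ trues-concat (All.map (trues≡suc-falses-IOPath _) paths) ⟩
    length ps + falses (concat ps) ≡⟨ cong (length ps +_) (↭-length (filter-↭ (T? ∘ not ∘ side) perm)) ⟩
    length ps + countSide side false ∎
    where
    open ≡-Reasoning
    perm : concat ps ↭ allFin (n (graph G))
    perm = unique∧complete⇒↭allFin
      (concat⁺ (All.map (proj₂ ∘ proj₂ ∘ proj₁) paths)
               (AllPairs.map (λ p#q {_} (v∈p , v∈q) → p#q _ v∈p v∈q) disjoint))
      (λ v → ∈-concat⁺ (cover v))

lemma1 : (k : ℕ) (G : IODigraph k) (side : Fin (n (graph G)) → Bool)
    → (∀ u v → Edge (graph G) u v → side u ≢ side v)
    → countSide side true ≡ suc (countSide side false)
    → (∀ j → side (inc G j) ≡ true)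
    → (∀ j → side (out G j) ≡ true)
    → SingleVisitCondition G
lemma1 k G side bipartite |V₁|≡1+|V₂| inc-V₁ out-V₁ (ps , 2≤#ps , paths , disjoint , cover) =
  <-irrefl refl (subst (2 ≤_) #ps≡1 2≤#ps)
  where
  #ps≡1 : length ps ≡ 1
  #ps≡1 = +-cancelʳ-≡ (countSide side false) (length ps) 1
    (trans (sym (IOPath-cover⇒countSide G side bipartite inc-V₁ out-V₁ paths disjoint cover)) |V₁|≡1+|V₂|)
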